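{- Let $\varepsilon>0$ and let $M$ be the matching returned by Algorithm A (described in the context) on a graph $G$ with any order of the edge stream. Then for every matching $M^*$ of $G$, $w(M^*)\le 2(1+\varepsilon)\,w(M)$; i.e., $M$ is a $2(1+\varepsilon)$-approximation of the maximum weight matching.
   Context: $G=(V,E,w)$ is a simple graph with positive edge weights $w_e>0$; $w(M)=\sum_{e\in M}w_e$ for a matching $M$. The edges arrive in a stream in arbitrary order. Algorithm A with parameter $\varepsilon$: initialize an empty stack $S$ and $\phi_v=0$ for every vertex $v$. For each edge $e=\{u,v\}$ in stream order: if $w_e<(1+\varepsilon)(\phi_u+\phi_v)$, skip $e$; otherwise set $w'_e=w_e-(\phi_u+\phi_v)$, then $\phi_u\leftarrow\phi_u+w'_e$, $\phi_v\leftarrow\phi_v+w'_e$, and push $e$ onto $S$. After the stream ends, set $M=\emptyset$ and repeatedly pop an edge $e$ from $S$ until $S$ is empty, adding $e$ to $M$ if no edge of $M$ shares an endpoint with $e$. Output $M$.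
   Formalization: The edge weights $w_e$ and the parameter ε are rational. -}

module Defs where

open import Data.Bool using (Bool; true; false; if_then_else_; _∨_)
open import Data.Fin using (Fin; _≟_)
open import Data.List using (List; []; _∷_; foldr)
open import Data.List.Membership.Propositional using (_∈_)
open import Data.List.Relation.Unary.All using (All)
open import Data.List.Relation.Unary.AllPairs using (AllPairs)
open import Data.Nat using (ℕ)
open import Data.Product using (_×_)
open import Data.Rational using (ℚ; 0ℚ; 1ℚ; _+_; _-_; _*_; _<_; _<?_)
open import Data.Sum using (_⊎_)
open import Relation.Binary.PropositionalEquality using (_≡_; _≢_)
open import Relation.Nullary using (¬_)
open import Relation.Nullary.Decidable using (⌊_⌋)

record Edge (n : ℕ) : Set where
  constructor edge
  field
    u : Fin n
    v : Fin n
    w : ℚ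
open Edge public

SameEnds : ∀ {n} → Edge n → Edge n → Set
SameEnds e f = (u e ≡ u f × v e ≡ v f) ⊎ (u e ≡ v f × v e ≡ u f)

-- A stream of edges describes a simple graph with positive edge weights:
-- no loops, positive weights, and every unordered pair occurs at most once
-- (so the stream lists each edge of G exactly once, in arbitrary order).
SimpleWeightedStream : ∀ {n} → List (Edge n) → Set
SimpleWeightedStream s =
  All (λ e → u e ≢ v e × 0ℚ < w e) s × AllPairs (λ e f → ¬ SameEnds e f) s

VertexDisjoint : ∀ {n} → Edge n → Edge n → Set
VertexDisjoint e f = u e ≢ u f × u e ≢ v f × v e ≢ u f × v e ≢ v f

IsMatchingOf : ∀ {n} → List (Edge n) → List (Edge n) → Set
IsMatchingOf s M = All (_∈ s) M × AllPairs VertexDisjoint M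

weight : ∀ {n} → List (Edge n) → ℚ
weight = foldr (λ e acc → w e + acc) 0ℚ

shares : ∀ {n} → Edge n → Edge n → Bool
shares e f = ⌊ u e ≟ u f ⌋ ∨ ⌊ u e ≟ v f ⌋ ∨ ⌊ v e ≟ u f ⌋ ∨ ⌊ v e ≟ v f ⌋

anyShares : ∀ {n} → Edge n → List (Edge n) → Bool
anyShares e [] = false
anyShares e (f ∷ M) = shares e f ∨ anyShares e M

bump : ∀ {n} → (Fin n → ℚ) → Fin n → ℚ → (Fin n → ℚ)
bump φ x a y = if ⌊ y ≟ x ⌋ then φ y + a else φ y

-- State of the streaming phase: potentials φ and stack S (head = top).
record State (n : ℕ) : Set where
  constructor state
  field
    φ     : Fin n → ℚ
    stack : List (Edge n)
open State public

step : ∀ {n} → ℚ → State n → Edge n → State n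
step ε (state φ S) e with w e <? ((1ℚ + ε) * (φ (u e) + φ (v e)))
... | Relation.Nullary.yes _ = state φ S
... | Relation.Nullary.no  _ =
  let w' = w e - (φ (u e) + φ (v e))
  in state (bump (bump φ (u e) w') (v e) w') (e ∷ S)

streamPhase : ∀ {n} → ℚ → List (Edge n) → State n
streamPhase ε s = go (state (λ _ → 0ℚ) []) s
  where
  go : _ → List _ → _
  go st []      = st
  go st (e ∷ es) = go (step ε st e) es

unwind : ∀ {n} → List (Edge n) → List (Edge n) → List (Edge n)
unwind M []      = M
unwind M (e ∷ S) = if anyShares e M then unwind M S else unwind (e ∷ M) S

algorithmA : ∀ {n} → ℚ → List (Edge n) → List (Edge n)
algorithmA ε s = unwind [] (stack (streamPhase ε s))

{-# OPTIONS --safe #-}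
-- Let the gain of a pushed edge f be w'_f ≥ 0, and let φ_x be the total gain of the pushed edges
-- at x. Potentials only grow, so at the end every edge e of the stream satisfies
-- w_e ≤ (1+ε)(φ_u + φ_v): a skipped edge satisfied it when it was skipped, a pushed edge right
-- after it was pushed. A matching M* meets each vertex at most once, so
-- Σ_{e∈M*} (φ_u + φ_v) ≤ Σ_x φ_x = 2 Σ_f w'_f. Finally the unwinding collects weight at least
-- Σ_f w'_f. With R the remaining stack and φ^R its potential, the final weight is at least
-- w(M) + Σ_{f∈R} w'_f − Σ_{e∈M} (φ^R_u + φ^R_v) at every stage: an accepted edge f pays for its
-- gain since w_f = w'_f + φ^R_u + φ^R_v, and a rejected one shares an endpoint with M, so popping
-- it lowers the last sum by at least w'_f.
module Submission where

open import Defs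
open import Data.Nat using (ℕ)
open import Data.List using (List)
open import Data.Rational using (ℚ; 0ℚ; 1ℚ; _+_; _*_; _<_; _≤_)

open import Data.Bool using (true; false; if_then_else_)
open import Data.Empty using (⊥-elim)
open import Relation.Nullary.Decidable using (⌊_⌋)
open import Data.Fin using (Fin; _≟_)
open import Data.List using ([]; _∷_; foldl; foldr; map)
open import Data.List.Relation.Unary.All as All using (All; []; _∷_)
open import Data.List.Relation.Unary.AllPairs using (AllPairs; []; _∷_)
open import Data.Product using (Σ-syntax; _×_; _,_; proj₁; proj₂)
open import Data.Rational using (_-_; -_; _<?_; nonNegative)
open import Data.Rational.Properties
  using (≤-refl; ≤-trans; ≤-reflexive; <⇒≤; ≮⇒≥; ≤ᵇ⇒≤; +-mono-≤; +-monoˡ-≤; +-monoʳ-≤;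
         +-identityʳ; +-identityˡ; +-comm; +-assoc; +-inverseʳ; *-zeroˡ; *-zeroʳ; *-distribˡ-+;
         *-monoˡ-≤-nonNeg; *-monoʳ-≤-nonNeg; module ≤-Reasoning)
open import Data.Rational.Solver using (module +-*-Solver)
open import Data.Sum using (_⊎_; inj₁; inj₂)
open import Function using (_∘_)
open import Relation.Binary.PropositionalEquality
  using (_≡_; _≢_; refl; sym; trans; cong; cong₂; ≢-sym; module ≡-Reasoning)
open import Relation.Nullary using (¬_; yes; no)
open +-*-Solver

p≤p+q : ∀ p {q} → 0ℚ ≤ q → p ≤ p + q
p≤p+q p 0≤q = ≤-trans (≤-reflexive (sym (+-identityʳ p))) (+-monoʳ-≤ p 0≤q)

p≤q+p : ∀ p {q} → 0ℚ ≤ q → p ≤ q + p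
p≤q+p p {q} 0≤q = ≤-trans (p≤p+q p 0≤q) (≤-reflexive (+-comm p q))

p≤q⇒0≤q-p : ∀ {p q} → p ≤ q → 0ℚ ≤ q - p
p≤q⇒0≤q-p {p} p≤q = ≤-trans (≤-reflexive (sym (+-inverseʳ p))) (+-monoˡ-≤ (- p) p≤q)

+-cancelʳ-≤ : ∀ {p q} r → p + r ≤ q + r → p ≤ q
+-cancelʳ-≤ {p} {q} r p+r≤q+r = begin
  p          ≡⟨ cancel p ⟩
  p + r - r  ≤⟨ +-monoˡ-≤ (- r) p+r≤q+r ⟩
  q + r - r  ≡⟨ sym (cancel q) ⟩
  q          ∎
  where
  open ≤-Reasoning
  cancel : ∀ x → x ≡ x + r - r
  cancel x = solve 2 (λ x r → x := x :+ r :- r) refl x r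

0≤1+p : ∀ {p} → 0ℚ ≤ p → 0ℚ ≤ 1ℚ + p
0≤1+p = +-mono-≤ {0ℚ} {1ℚ} (≤ᵇ⇒≤ _)

p≤[1+ε]*p : ∀ {ε p} → 0ℚ ≤ ε → 0ℚ ≤ p → p ≤ (1ℚ + ε) * p
p≤[1+ε]*p {ε} {p} 0≤ε 0≤p = begin
  p              ≤⟨ p≤p+q p 0≤εp ⟩
  p + ε * p      ≡⟨ solve 2 (λ ε p → p :+ ε :* p := (con 1ℚ :+ ε) :* p) refl ε p ⟩
  (1ℚ + ε) * p   ∎
  where
  open ≤-Reasoning
  0≤εp : 0ℚ ≤ ε * p
  0≤εp = ≤-trans (≤-reflexive (sym (*-zeroˡ p))) (*-monoʳ-≤-nonNeg p {{nonNegative 0≤p}} 0≤ε)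

sumBy : ∀ {A : Set} → (A → ℚ) → List A → ℚ
sumBy f = foldr (λ x acc → f x + acc) 0ℚ

module _ {A : Set} where

  sumBy-cong : ∀ {f g : A → ℚ} → (∀ x → f x ≡ g x) → ∀ xs → sumBy f xs ≡ sumBy g xs
  sumBy-cong f≗g []       = refl
  sumBy-cong f≗g (x ∷ xs) = cong₂ _+_ (f≗g x) (sumBy-cong f≗g xs)

  sumBy-+ : ∀ (f g : A → ℚ) xs → sumBy (λ x → f x + g x) xs ≡ sumBy f xs + sumBy g xs
  sumBy-+ f g []       = sym (+-identityʳ 0ℚ)
  sumBy-+ f g (x ∷ xs) = trans (cong (f x + g x +_) (sumBy-+ f g xs))
    (solve 4 (λ a b c d → (a :+ b) :+ (c :+ d) := (a :+ c) :+ (b :+ d)) refl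
      (f x) (g x) (sumBy f xs) (sumBy g xs))

  sumBy-* : ∀ c (f : A → ℚ) xs → sumBy (λ x → c * f x) xs ≡ c * sumBy f xs
  sumBy-* c f []       = sym (*-zeroʳ c)
  sumBy-* c f (x ∷ xs) = trans (cong (c * f x +_) (sumBy-* c f xs)) (sym (*-distribˡ-+ c (f x) (sumBy f xs)))

  sumBy-mono : ∀ {f g : A → ℚ} {xs} → All (λ x → f x ≤ g x) xs → sumBy f xs ≤ sumBy g xs
  sumBy-mono []           = ≤-refl
  sumBy-mono (fx≤gx ∷ ps) = +-mono-≤ fx≤gx (sumBy-mono ps)

  sumBy-nonNeg : ∀ {f : A → ℚ} → (∀ x → 0ℚ ≤ f x) → ∀ xs → 0ℚ ≤ sumBy f xs
  sumBy-nonNeg 0≤f []       = ≤-refl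
  sumBy-nonNeg 0≤f (x ∷ xs) = +-mono-≤ (0≤f x) (sumBy-nonNeg 0≤f xs)

  sumBy-zero : ∀ {f : A → ℚ} {xs} → All (λ x → f x ≡ 0ℚ) xs → sumBy f xs ≡ 0ℚ
  sumBy-zero []          = refl
  sumBy-zero (fx≡0 ∷ ps) = cong₂ _+_ fx≡0 (sumBy-zero ps)

foldl-unique : ∀ {A B C : Set} (f : A → B → A) (g : C → A → List B → A) →
               (∀ c a → g c a [] ≡ a) → (∀ c a b bs → g c a (b ∷ bs) ≡ g c (f a b) bs) →
               ∀ c a bs → g c a bs ≡ foldl f a bs
foldl-unique f g g[] g∷ c a []       = g[] c a
foldl-unique f g g[] g∷ c a (b ∷ bs) = trans (g∷ c a b bs) (foldl-unique f g g[] g∷ c (f a b) bs)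

module _ {n : ℕ} where

  spike : Fin n → ℚ → Fin n → ℚ
  spike x a y = if ⌊ y ≟ x ⌋ then a else 0ℚ

  bump≡+spike : ∀ (φ : Fin n → ℚ) x a y → bump φ x a y ≡ φ y + spike x a y
  bump≡+spike φ x a y with y ≟ x
  ... | yes _ = refl
  ... | no  _ = sym (+-identityʳ (φ y))

  spike-nonNeg : ∀ x {a} y → 0ℚ ≤ a → 0ℚ ≤ spike x a y
  spike-nonNeg x y 0≤a with y ≟ x
  ... | yes _ = 0≤a
  ... | no  _ = ≤-refl

  spike-≢ : ∀ {x a y} → y ≢ x → spike x a y ≡ 0ℚ
  spike-≢ {x} {y = y} y≢x with y ≟ x
  ... | yes y≡x = ⊥-elim (y≢x y≡x)
  ... | no  _   = refl

  endpointSum : (Fin n → ℚ) → Edge n → ℚ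
  endpointSum φ e = φ (u e) + φ (v e)

  Incident : Fin n → Edge n → Set
  Incident x e = x ≡ u e ⊎ x ≡ v e

  Avoids : Fin n → Edge n → Set
  Avoids x e = u e ≢ x × v e ≢ x

  disjoint-avoids : ∀ {x} e → Incident x e → ∀ {M} → All (VertexDisjoint e) M → All (Avoids x) M
  disjoint-avoids e (inj₁ refl) = All.map λ (ue≢uf , ue≢vf , _ , _) → ≢-sym ue≢uf , ≢-sym ue≢vf
  disjoint-avoids e (inj₂ refl) = All.map λ (_ , _ , ve≢uf , ve≢vf) → ≢-sym ve≢uf , ≢-sym ve≢vf

  shares-incident : ∀ f e → shares f e ≡ true → Incident (u e) f ⊎ Incident (v e) f
  shares-incident f e eq with u f ≟ u e | u f ≟ v e | v f ≟ u e | v f ≟ v e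
  ... | yes p | _     | _     | _     = inj₁ (inj₁ (sym p))
  ... | no _  | yes p | _     | _     = inj₂ (inj₁ (sym p))
  ... | no _  | no _  | yes p | _     = inj₁ (inj₂ (sym p))
  ... | no _  | no _  | no _  | yes p = inj₂ (inj₂ (sym p))
  shares-incident f e () | no _ | no _ | no _ | no _

  deposit : Edge n → ℚ → Fin n → ℚ
  deposit f b y = spike (u f) b y + spike (v f) b y

  deposit-nonNeg : ∀ f {b} y → 0ℚ ≤ b → 0ℚ ≤ deposit f b y
  deposit-nonNeg f y 0≤b = +-mono-≤ (spike-nonNeg (u f) y 0≤b) (spike-nonNeg (v f) y 0≤b)

  deposit-incident : ∀ f {b} y → 0ℚ ≤ b → Incident y f → b ≤ deposit f b y
  deposit-incident f {b} y 0≤b (inj₁ refl) with u f ≟ u f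
  ... | yes _   = p≤p+q b (spike-nonNeg (v f) y 0≤b)
  ... | no  u≢u = ⊥-elim (u≢u refl)
  deposit-incident f {b} y 0≤b (inj₂ refl) with v f ≟ v f
  ... | yes _   = p≤q+p b (spike-nonNeg (u f) y 0≤b)
  ... | no  v≢v = ⊥-elim (v≢v refl)

  endpointSum-nonNeg : ∀ {φ : Fin n → ℚ} → (∀ y → 0ℚ ≤ φ y) → ∀ e → 0ℚ ≤ endpointSum φ e
  endpointSum-nonNeg 0≤φ e = +-mono-≤ (0≤φ (u e)) (0≤φ (v e))

  depositOn : Edge n → ℚ → List (Edge n) → ℚ
  depositOn f b = sumBy (endpointSum (deposit f b))

  depositOn-nonNeg : ∀ f {b} M → 0ℚ ≤ b → 0ℚ ≤ depositOn f b M
  depositOn-nonNeg f M 0≤b = sumBy-nonNeg (endpointSum-nonNeg (λ y → deposit-nonNeg f y 0≤b)) M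

  endpointSum-deposit-shared : ∀ f {b} e → 0ℚ ≤ b → shares f e ≡ true →
                               b ≤ endpointSum (deposit f b) e
  endpointSum-deposit-shared f e 0≤b fe with shares-incident f e fe
  ... | inj₁ ue = ≤-trans (deposit-incident f (u e) 0≤b ue) (p≤p+q _ (deposit-nonNeg f (v e) 0≤b))
  ... | inj₂ ve = ≤-trans (deposit-incident f (v e) 0≤b ve) (p≤q+p _ (deposit-nonNeg f (u e) 0≤b))

  depositOn-shared : ∀ f {b} M → 0ℚ ≤ b → anyShares f M ≡ true → b ≤ depositOn f b M
  depositOn-shared f []      0≤b ()
  depositOn-shared f (e ∷ M) 0≤b shared with shares f e in fe
  ... | true  = ≤-trans (endpointSum-deposit-shared f e 0≤b fe) (p≤p+q _ (depositOn-nonNeg f M 0≤b))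
  ... | false = ≤-trans (depositOn-shared f M 0≤b shared)
                        (p≤q+p _ (endpointSum-nonNeg (λ y → deposit-nonNeg f y 0≤b) e))

  spikeOn : Fin n → ℚ → List (Edge n) → ℚ
  spikeOn x b = sumBy (endpointSum (spike x b))

  spikeOn-avoiding : ∀ x b {M} → All (Avoids x) M → spikeOn x b M ≡ 0ℚ
  spikeOn-avoiding x b =
    sumBy-zero ∘ All.map λ (ue≢x , ve≢x) → cong₂ _+_ (spike-≢ ue≢x) (spike-≢ ve≢x)

  spikeOn-matching : ∀ x {b} M → 0ℚ ≤ b → All (λ e → u e ≢ v e) M → AllPairs VertexDisjoint M →
                     spikeOn x b M ≤ b
  spikeOn-matching x []      0≤b []              []                = 0≤b
  spikeOn-matching x {b} (e ∷ M) 0≤b (ue≢ve ∷ loopless) (disjoint ∷ disjoints) with u e ≟ x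
  ... | yes ue≡x = ≤-reflexive (begin
    b + spike x b (v e) + spikeOn x b M
      ≡⟨ cong₂ (λ s r → b + s + r) (spike-≢ {a = b} (λ ve≡x → ue≢ve (trans ue≡x (sym ve≡x))))
                                   (spikeOn-avoiding x b (disjoint-avoids e (inj₁ (sym ue≡x)) disjoint)) ⟩
    b + 0ℚ + 0ℚ
      ≡⟨ solve 1 (λ b → b :+ con 0ℚ :+ con 0ℚ := b) refl b ⟩
    b ∎)
    where open ≡-Reasoning
  ... | no _ with v e ≟ x
  ...   | yes ve≡x = ≤-reflexive (begin
    0ℚ + b + spikeOn x b M
      ≡⟨ cong (0ℚ + b +_) (spikeOn-avoiding x b (disjoint-avoids e (inj₂ (sym ve≡x)) disjoint)) ⟩
    0ℚ + b + 0ℚ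
      ≡⟨ solve 1 (λ b → con 0ℚ :+ b :+ con 0ℚ := b) refl b ⟩
    b ∎)
    where open ≡-Reasoning
  ...   | no _ = ≤-trans (≤-reflexive (+-identityˡ _)) (spikeOn-matching x M 0≤b loopless disjoints)

  depositOn-matching : ∀ f {b} M → 0ℚ ≤ b → All (λ e → u e ≢ v e) M → AllPairs VertexDisjoint M →
                       depositOn f b M ≤ b + b
  depositOn-matching f {b} M 0≤b loopless disjoint = begin
    depositOn f b M
      ≡⟨ sumBy-cong regroup M ⟩
    sumBy (λ e → endpointSum (spike (u f) b) e + endpointSum (spike (v f) b) e) M
      ≡⟨ sumBy-+ (endpointSum (spike (u f) b)) (endpointSum (spike (v f) b)) M ⟩
    spikeOn (u f) b M + spikeOn (v f) b M
      ≤⟨ +-mono-≤ (spikeOn-matching (u f) M 0≤b loopless disjoint)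
                  (spikeOn-matching (v f) M 0≤b loopless disjoint) ⟩
    b + b ∎
    where
    open ≤-Reasoning
    regroup : ∀ e → endpointSum (deposit f b) e ≡ endpointSum (spike (u f) b) e + endpointSum (spike (v f) b) e
    regroup e = solve 4 (λ a c a' c' → (a :+ c) :+ (a' :+ c') := (a :+ a') :+ (c :+ c')) refl
      (spike (u f) b (u e)) (spike (v f) b (u e)) (spike (u f) b (v e)) (spike (v f) b (v e))

  -- The stack, top first, with each edge paired with its gain.
  Ledger : Set
  Ledger = List (Edge n × ℚ)

  potential : Ledger → Fin n → ℚ
  potential []            y = 0ℚ
  potential ((f , b) ∷ T) y = potential T y + deposit f b y

  gains : Ledger → ℚ
  gains = sumBy proj₂

  -- In (f , b) ∷ T, potential T is φ at the moment f was pushed, so b is the paper's w'_f.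
  data Consistent : Ledger → Set where
    [] : Consistent []
    push : ∀ {T f b} → 0ℚ ≤ b → w f ≡ b + endpointSum (potential T) f → Consistent T →
           Consistent ((f , b) ∷ T)

  potential-nonNeg : ∀ {T} → Consistent T → ∀ y → 0ℚ ≤ potential T y
  potential-nonNeg []                      y = ≤-refl
  potential-nonNeg (push {f = f} 0≤b _ cT) y = +-mono-≤ (potential-nonNeg cT y) (deposit-nonNeg f y 0≤b)

  potentialOn : Ledger → List (Edge n) → ℚ
  potentialOn T = sumBy (endpointSum (potential T))

  potentialOn-push : ∀ T f b M → potentialOn ((f , b) ∷ T) M ≡ potentialOn T M + depositOn f b M
  potentialOn-push T f b M =
    trans (sumBy-cong regroup M) (sumBy-+ (endpointSum (potential T)) (endpointSum (deposit f b)) M)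
    where
    regroup : ∀ e → endpointSum (potential ((f , b) ∷ T)) e
                  ≡ endpointSum (potential T) e + endpointSum (deposit f b) e
    regroup e = solve 4 (λ p d p' d' → (p :+ d) :+ (p' :+ d') := (p :+ p') :+ (d :+ d')) refl
      (potential T (u e)) (deposit f b (u e)) (potential T (v e)) (deposit f b (v e))

  potentialOn-matching : ∀ {T} M → Consistent T → All (λ e → u e ≢ v e) M → AllPairs VertexDisjoint M →
                         potentialOn T M ≤ gains T + gains T
  potentialOn-matching M [] _ _ = ≤-reflexive (sumBy-zero {xs = M} (All.tabulate λ _ → refl))
  potentialOn-matching {(f , b) ∷ T} M (push 0≤b _ cT) loopless disjoint = begin
    potentialOn ((f , b) ∷ T) M          ≡⟨ potentialOn-push T f b M ⟩
    potentialOn T M + depositOn f b M    ≤⟨ +-mono-≤ (potentialOn-matching M cT loopless disjoint)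
                                                     (depositOn-matching f M 0≤b loopless disjoint) ⟩
    (gains T + gains T) + (b + b)        ≡⟨ solve 2 (λ g b → (g :+ g) :+ (b :+ b) := (b :+ g) :+ (b :+ g))
                                                    refl (gains T) b ⟩
    (b + gains T) + (b + gains T)        ∎
    where open ≤-Reasoning

  potentialOn-push-≥ : ∀ T f {b} M → 0ℚ ≤ b → potentialOn T M ≤ potentialOn ((f , b) ∷ T) M
  potentialOn-push-≥ T f {b} M 0≤b =
    ≤-trans (p≤p+q _ (depositOn-nonNeg f M 0≤b)) (≤-reflexive (sym (potentialOn-push T f b M)))

  potentialOn-push-shared : ∀ T f {b} M → 0ℚ ≤ b → anyShares f M ≡ true →
                            potentialOn T M + b ≤ potentialOn ((f , b) ∷ T) M
  potentialOn-push-shared T f {b} M 0≤b shared =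
    ≤-trans (+-monoʳ-≤ (potentialOn T M) (depositOn-shared f M 0≤b shared))
            (≤-reflexive (sym (potentialOn-push T f b M)))

  unwind-gains : ∀ T M → Consistent T →
                 weight M + gains T ≤ weight (unwind M (map proj₁ T)) + potentialOn T M
  unwind-gains []            M [] = +-monoʳ-≤ (weight M) (sumBy-nonNeg (λ _ → ≤-refl) M)
  unwind-gains ((f , b) ∷ T) M (push 0≤b w≡ cT) with anyShares f M in shared
  ... | true = begin
    weight M + (b + gains T)       ≡⟨ solve 3 (λ m b g → m :+ (b :+ g) := (m :+ g) :+ b)
                                              refl (weight M) b (gains T) ⟩
    (weight M + gains T) + b       ≤⟨ +-monoˡ-≤ b (unwind-gains T M cT) ⟩
    (W + potentialOn T M) + b      ≡⟨ +-assoc W (potentialOn T M) b ⟩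
    W + (potentialOn T M + b)      ≤⟨ +-monoʳ-≤ W (potentialOn-push-shared T f M 0≤b shared) ⟩
    W + potentialOn ((f , b) ∷ T) M ∎
    where
    open ≤-Reasoning
    W : ℚ
    W = weight (unwind M (map proj₁ T))
  ... | false = +-cancelʳ-≤ c (begin
    (weight M + (b + gains T)) + c  ≡⟨ solve 4 (λ m b g c → (m :+ (b :+ g)) :+ c := ((b :+ c) :+ m) :+ g) refl
                                                (weight M) b (gains T) c ⟩
    ((b + c) + weight M) + gains T  ≡⟨ cong (λ x → x + weight M + gains T) (sym w≡) ⟩
    weight (f ∷ M) + gains T        ≤⟨ unwind-gains T (f ∷ M) cT ⟩
    W + potentialOn T (f ∷ M)       ≡⟨ solve 3 (λ x c p → x :+ (c :+ p) := (x :+ p) :+ c)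
                                               refl W c (potentialOn T M) ⟩
    (W + potentialOn T M) + c       ≤⟨ +-monoˡ-≤ c (+-monoʳ-≤ W (potentialOn-push-≥ T f M 0≤b)) ⟩
    (W + potentialOn ((f , b) ∷ T) M) + c ∎)
    where
    open ≤-Reasoning
    W c : ℚ
    W = weight (unwind (f ∷ M) (map proj₁ T))
    c = endpointSum (potential T) f

  gains≤weight-unwind : ∀ {T} → Consistent T → gains T ≤ weight (unwind [] (map proj₁ T))
  gains≤weight-unwind {T} cT = begin
    gains T                                   ≡⟨ sym (+-identityˡ (gains T)) ⟩
    0ℚ + gains T                              ≤⟨ unwind-gains T [] cT ⟩
    weight (unwind [] (map proj₁ T)) + 0ℚ     ≡⟨ +-identityʳ _ ⟩
    weight (unwind [] (map proj₁ T))          ∎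
    where open ≤-Reasoning

  Covered : ℚ → (Fin n → ℚ) → Edge n → Set
  Covered ε φ e = w e ≤ (1ℚ + ε) * endpointSum φ e

  covered-mono : ∀ {ε φ ψ e} → 0ℚ ≤ ε → (∀ y → φ y ≤ ψ y) → Covered ε φ e → Covered ε ψ e
  covered-mono {ε} {e = e} 0≤ε φ≤ψ covered =
    ≤-trans covered (*-monoˡ-≤-nonNeg (1ℚ + ε) {{nonNegative (0≤1+p 0≤ε)}}
                                      (+-mono-≤ (φ≤ψ (u e)) (φ≤ψ (v e))))

  weight≤[1+ε]*potentialOn : ∀ ε T {M} → All (Covered ε (potential T)) M →
                             weight M ≤ (1ℚ + ε) * potentialOn T M
  weight≤[1+ε]*potentialOn ε T {M} covered =
    ≤-trans (sumBy-mono covered) (≤-reflexive (sumBy-* (1ℚ + ε) (endpointSum (potential T)) M))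

  record Invariant (st : State n) : Set where
    field
      ledger      : Ledger
      consistent  : Consistent ledger
      φ≗potential : ∀ y → φ st y ≡ potential ledger y
      stack≡      : stack st ≡ map proj₁ ledger

    φ-nonNeg : ∀ y → 0ℚ ≤ φ st y
    φ-nonNeg y = ≤-trans (potential-nonNeg consistent y) (≤-reflexive (sym (φ≗potential y)))

  initial : State n
  initial = state (λ _ → 0ℚ) []

  initial-invariant : Invariant initial
  initial-invariant = record { ledger = [] ; consistent = [] ; φ≗potential = λ _ → refl ; stack≡ = refl }

  -- streamPhase runs a local function that cannot be named. The metavariable below is created
  -- before the stream, state and tail are abstracted, so unification can solve it to that function.
  streamPhase≡foldl : ∀ ε s → streamPhase ε s ≡ foldl (step ε) initial s
  streamPhase≡foldl ε []       = refl
  streamPhase≡foldl ε (e ∷ es)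
    with foldl-unique (step ε) _ (λ _ _ → refl) (λ _ _ _ _ → refl) | e ∷ es | step ε initial e | es
  ... | go≡foldl | s | st | xs = go≡foldl s st xs

  gain : (Fin n → ℚ) → Edge n → ℚ
  gain φ e = w e - endpointSum φ e

  pushed : (Fin n → ℚ) → Edge n → Fin n → ℚ
  pushed φ e = bump (bump φ (u e) (gain φ e)) (v e) (gain φ e)

  pushed≡ : ∀ φ e y → pushed φ e y ≡ φ y + deposit e (gain φ e) y
  pushed≡ φ e y = begin
    pushed φ e y                             ≡⟨ bump≡+spike (bump φ (u e) g) (v e) g y ⟩
    bump φ (u e) g y + spike (v e) g y       ≡⟨ cong (_+ spike (v e) g y) (bump≡+spike φ (u e) g y) ⟩
    φ y + spike (u e) g y + spike (v e) g y  ≡⟨ +-assoc (φ y) _ _ ⟩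
    φ y + deposit e g y                      ∎
    where
    open ≡-Reasoning
    g : ℚ
    g = gain φ e

  pushed-≥ : ∀ φ e → 0ℚ ≤ gain φ e → ∀ y → φ y ≤ pushed φ e y
  pushed-≥ φ e 0≤g y =
    ≤-trans (p≤p+q (φ y) (deposit-nonNeg e y 0≤g)) (≤-reflexive (sym (pushed≡ φ e y)))

  pushed-covers : ∀ {ε} φ e → 0ℚ ≤ ε → 0ℚ ≤ endpointSum φ e → 0ℚ ≤ gain φ e →
                  Covered ε (pushed φ e) e
  pushed-covers {ε} φ e 0≤ε 0≤a 0≤g = begin
    w e                                          ≡⟨ solve 2 (λ c a → c := a :+ (c :- a)) refl (w e) a ⟩
    a + g                                        ≤⟨ +-monoʳ-≤ a (≤-trans (deposit-incident e (u e) 0≤g (inj₁ refl))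
                                                                         (p≤p+q _ (deposit-nonNeg e (v e) 0≤g))) ⟩
    a + endpointSum (deposit e g) e              ≡⟨ regroup ⟩
    endpointSum (pushed φ e) e                   ≤⟨ p≤[1+ε]*p 0≤ε 0≤pushed ⟩
    (1ℚ + ε) * endpointSum (pushed φ e) e        ∎
    where
    open ≤-Reasoning
    a g : ℚ
    a = endpointSum φ e
    g = gain φ e
    regroup : a + endpointSum (deposit e g) e ≡ endpointSum (pushed φ e) e
    regroup = trans (solve 4 (λ p q d d' → (p :+ q) :+ (d :+ d') := (p :+ d) :+ (q :+ d')) refl
                       (φ (u e)) (φ (v e)) (deposit e g (u e)) (deposit e g (v e)))
                    (sym (cong₂ _+_ (pushed≡ φ e (u e)) (pushed≡ φ e (v e))))
    0≤pushed : 0ℚ ≤ endpointSum (pushed φ e) e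
    0≤pushed = ≤-trans (+-mono-≤ 0≤a (endpointSum-nonNeg (λ y → deposit-nonNeg e y 0≤g) e))
                       (≤-reflexive regroup)

  push-invariant : ∀ {φ S} e → Invariant (state φ S) → 0ℚ ≤ gain φ e →
                   Invariant (state (pushed φ e) (e ∷ S))
  push-invariant {φ} e I 0≤g = record
    { ledger      = (e , gain φ e) ∷ ledger
    ; consistent  = push 0≤g w≡ consistent
    ; φ≗potential = λ y → trans (pushed≡ φ e y) (cong (_+ deposit e (gain φ e) y) (φ≗potential y))
    ; stack≡      = cong (e ∷_) stack≡
    }
    where
    open Invariant I
    w≡ : w e ≡ gain φ e + endpointSum (potential ledger) e
    w≡ = trans (solve 2 (λ c a → c := (c :- a) :+ a) refl (w e) (endpointSum φ e))
               (cong (gain φ e +_) (cong₂ _+_ (φ≗potential (u e)) (φ≗potential (v e))))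

  module _ {ε : ℚ} (0≤ε : 0ℚ ≤ ε) where

    gain-nonNeg : ∀ {φ S} e → Invariant (state φ S) → ¬ w e < (1ℚ + ε) * endpointSum φ e → 0ℚ ≤ gain φ e
    gain-nonNeg e I not-skipped =
      p≤q⇒0≤q-p (≤-trans (p≤[1+ε]*p 0≤ε (endpointSum-nonNeg (Invariant.φ-nonNeg I) e)) (≮⇒≥ not-skipped))

    step-invariant : ∀ {st} e → Invariant st → Invariant (step ε st e)
    step-invariant {state φ S} e I with w e <? (1ℚ + ε) * endpointSum φ e
    ... | yes _        = I
    ... | no  ¬skipped = push-invariant e I (gain-nonNeg e I ¬skipped)

    step-≥ : ∀ {st} e → Invariant st → ∀ y → φ st y ≤ φ (step ε st e) y
    step-≥ {state φ S} e I with w e <? (1ℚ + ε) * endpointSum φ e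
    ... | yes _        = λ _ → ≤-refl
    ... | no  ¬skipped = pushed-≥ φ e (gain-nonNeg e I ¬skipped)

    step-covers : ∀ {st} e → Invariant st → Covered ε (φ (step ε st e)) e
    step-covers {state φ S} e I with w e <? (1ℚ + ε) * endpointSum φ e
    ... | yes skipped  = <⇒≤ skipped
    ... | no  ¬skipped = pushed-covers φ e 0≤ε 0≤a (gain-nonNeg e I ¬skipped)
      where
      0≤a : 0ℚ ≤ endpointSum φ e
      0≤a = endpointSum-nonNeg (Invariant.φ-nonNeg I) e

    foldl-invariant : ∀ {st} es → Invariant st → Invariant (foldl (step ε) st es)
    foldl-invariant []       I = I
    foldl-invariant (e ∷ es) I = foldl-invariant es (step-invariant e I)

    foldl-≥ : ∀ {st} es → Invariant st → ∀ y → φ st y ≤ φ (foldl (step ε) st es) y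
    foldl-≥ []       I y = ≤-refl
    foldl-≥ (e ∷ es) I y = ≤-trans (step-≥ e I y) (foldl-≥ es (step-invariant e I) y)

    foldl-covers : ∀ {st} es → Invariant st → All (Covered ε (φ (foldl (step ε) st es))) es
    foldl-covers []       I = []
    foldl-covers (e ∷ es) I =
      covered-mono 0≤ε (foldl-≥ es I′) (step-covers e I) ∷ foldl-covers es I′
      where
      I′ : Invariant (step ε _ e)
      I′ = step-invariant e I

    streamPhase-ledger : ∀ s → Σ[ T ∈ Ledger ]
      Consistent T × stack (streamPhase ε s) ≡ map proj₁ T × All (Covered ε (potential T)) s
    streamPhase-ledger s rewrite streamPhase≡foldl ε s =
      ledger , consistent , stack≡ ,
      All.map (covered-mono 0≤ε (λ y → ≤-reflexive (φ≗potential y))) (foldl-covers s initial-invariant)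
      where open Invariant (foldl-invariant s initial-invariant)

lemma2 : ∀ {n : ℕ} (ε : ℚ) → 0ℚ < ε →
         (s : List (Edge n)) → SimpleWeightedStream s →
         (Mstar : List (Edge n)) → IsMatchingOf s Mstar →
         weight Mstar ≤ ((1ℚ + 1ℚ) * (1ℚ + ε)) * weight (algorithmA ε s)
lemma2 ε 0<ε s (simple , _) Mstar (Mstar⊆s , disjoint)
  with streamPhase-ledger (<⇒≤ 0<ε) s
... | T , consistent , stack≡ , covered = begin
  weight Mstar                    ≤⟨ weight≤[1+ε]*potentialOn ε T (All.map (All.lookup covered) Mstar⊆s) ⟩
  (1ℚ + ε) * potentialOn T Mstar  ≤⟨ *-monoˡ-≤-nonNeg (1ℚ + ε) {{nonNegative (0≤1+p (<⇒≤ 0<ε))}} (begin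
    potentialOn T Mstar             ≤⟨ potentialOn-matching Mstar consistent loopless disjoint ⟩
    gains T + gains T               ≤⟨ +-mono-≤ gains≤W gains≤W ⟩
    W + W                           ∎) ⟩
  (1ℚ + ε) * (W + W)              ≡⟨ solve 2 (λ ε W → (con 1ℚ :+ ε) :* (W :+ W)
                                                   := ((con 1ℚ :+ con 1ℚ) :* (con 1ℚ :+ ε)) :* W) refl ε W ⟩
  ((1ℚ + 1ℚ) * (1ℚ + ε)) * W      ∎
  where
  open ≤-Reasoning
  W : ℚ
  W = weight (algorithmA ε s)
  loopless : All (λ e → u e ≢ v e) Mstar
  loopless = All.map (λ e∈s → proj₁ (All.lookup simple e∈s)) Mstar⊆s
  gains≤W : gains T ≤ W
  gains≤W = ≤-trans (gains≤weight-unwind consistent)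
                    (≤-reflexive (cong (λ S → weight (unwind [] S)) (sym stack≡)))
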